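{- Let $A$ be a finite alphabet containing at least two letters. There is no finite set $\mathcal{S}$ of nonerasing endomorphisms of $A^*$ such that the set $\mathcal{E}$ of episturmian words over $A$ equals $\mathrm{Stab}(\mathcal{S})$.
   Context: Infinite words are right infinite. A factor $u$ of $\mathbf{w}$ is left special if $xu$ and $yu$ are factors for two distinct letters $x,y$. An infinite word is episturmian if its set of factors is closed under reversal and it has at most one left special factor of each length. $\mathrm{Stab}(\mathcal{S})$ is the set of infinite words $\mathbf{w}$ for which there exist $(\sigma_n)_{n\ge1}\in\mathcal{S}^\omega$ and infinite words $(\mathbf{w}_n)_{n\ge0}$ with $\mathbf{w}_0=\mathbf{w}$ and $\mathbf{w}_n=\sigma_{n+1}(\mathbf{w}_{n+1})$ for all $n\ge0$. -}

module Defs where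

open import Data.Nat using (ℕ; zero; suc; _+_; _<_)
open import Data.Fin using (Fin)
open import Data.List using (List; []; _∷_; length; reverse; concatMap)
open import Data.List.Membership.Propositional using (_∈_)
open import Data.List.Relation.Unary.All using (All)
open import Data.Product using (Σ; _×_; ∃)
open import Relation.Binary.PropositionalEquality using (_≡_; _≢_)
open import Function.Bundles using (_⇔_)

Word : ℕ → Set
Word n = ℕ → Fin n

pref : ∀ {n} → Word n → ℕ → List (Fin n)
pref w zero    = []
pref w (suc m) = w 0 ∷ pref (λ i → w (suc i)) m

shift : ∀ {n} → Word n → ℕ → Word n
shift w i = λ j → w (i + j)

Factor : ∀ {n} → List (Fin n) → Word n → Set
Factor u w = ∃ λ i → pref (shift w i) (length u) ≡ u

LeftSpecial : ∀ {n} → List (Fin n) → Word n → Set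
LeftSpecial {n} u w =
  Σ (Fin n) λ x → Σ (Fin n) λ y → x ≢ y × Factor (x ∷ u) w × Factor (y ∷ u) w

Episturmian : ∀ {n} → Word n → Set
Episturmian w =
  (∀ u → Factor u w → Factor (reverse u) w) ×
  (∀ u v → LeftSpecial u w → LeftSpecial v w → length u ≡ length v → u ≡ v)

-- an endomorphism of A* is determined by the images of the letters
Morphism : ℕ → Set
Morphism n = Fin n → List (Fin n)

NonErasing : ∀ {n} → Morphism n → Set
NonErasing σ = ∀ a → 0 < length (σ a)

-- IsImage σ v w  :  w = σ(v)  (σ extended to infinite words).
-- For nonerasing σ the prefixes σ(v[0..m)) have unbounded length,
-- so this determines w completely.
IsImage : ∀ {n} → Morphism n → Word n → Word n → Set
IsImage σ v w = ∀ m →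
  pref w (length (concatMap σ (pref v m))) ≡ concatMap σ (pref v m)

-- Stab(S): w₀ = w, wₖ = σₖ₊₁(wₖ₊₁), all σₖ ∈ S.
-- (σs k plays the role of σ_{k+1}.)
Stab : ∀ {n} → List (Morphism n) → Word n → Set
Stab {n} S w =
  Σ (ℕ → Morphism n) λ σs → Σ (ℕ → Word n) λ ws →
    (∀ k → σs k ∈ S) ×
    (∀ i → ws 0 i ≡ w i) ×
    (∀ k → IsImage (σs k) (ws (suc k)) (ws k))

-- Fix letters o ≠ ι. Every periodic word (ιoᵏ)^ω is episturmian, while ιo^ω is not: ιo occurs
-- in it but oι does not. Let S be finite and nonerasing with Stab(S) the episturmian words, take a
-- derivation (ιoᵏ)^ω = C_l(w_l) with C_l = σ₁ ⋯ σ_l, and let L bound the lengths of the σ(a).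
-- For l ≤ K the blocks C_l(w_l(0)) and C_l(w_l(1)) have length ≤ L^K, so for k = 2 L^K they lie
-- in the prefix ιoᵏ: C_l(w_l(0)) ∈ ιo* and C_l(w_l(1)) ∈ o*. The state (w_l(0), set of letters
-- d with C_l(d) ∈ o*) takes at most K values, so it repeats at levels i < j ≤ K. Then
-- τ = σ_{i+1} ⋯ σ_j maps c = w_i(0) to c t and preserves the set Q of letters sent into o* by C_i,
-- with t ∈ Q* and w_j(1) ∈ Q. Hence some power of τ fixes a word y ∈ c Q^ω. Being a fixed point
-- of a composition of morphisms of S, y can be desubstituted forever, and so can its image
-- C_i(y) = ιo^ω; thus ιo^ω ∈ Stab(S) although it is not episturmian.

module Submission where

open import Defs
open import Data.Nat using (ℕ; _≤_)
open import Data.List using (List)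
open import Data.List.Relation.Unary.All using (All)
open import Data.Product using (Σ; _×_)
open import Relation.Nullary using (¬_)
open import Function.Bundles using (_⇔_)

open import Data.Nat using (zero; suc; _+_; _*_; _∸_; _^_; _<_; z≤n; s≤s)
open import Data.Nat.Properties
open import Data.Nat.Divisibility using (_∣_; _∣?_; divides; ∣⇒≤; ∣m+n∣m⇒∣n)
open import Data.Nat.ListAction using (sum)
open import Data.Nat.Tactic.RingSolver using (solve-∀)
open import Data.Fin using (Fin; toℕ) renaming (_<_ to _<ᶠ_)
open import Data.Fin.Patterns using (0F; 1F)
open import Data.Fin.Properties using (pigeonhole; toℕ<n) renaming (_≟_ to _≟ᶠ_)
open import Data.List
  using ([]; _∷_; _++_; [_]; length; lookup; concat; concatMap; replicate; applyUpTo; reverse; map;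
         allFin; cartesianProduct)
open import Data.List.Properties
  using (∷-injectiveˡ; ∷-injectiveʳ; ++-identityʳ; ++-assoc; length-++; length-reverse;
         reverse-++; length-applyUpTo; concatMap-++; concatMap-pure; concatMap-cong)
open import Data.List.Relation.Unary.All using ([]; _∷_; all?) renaming (lookup to lookupᴬ; map to mapᴬ)
open import Data.List.Relation.Unary.All.Properties
  using (++⁺; ++⁻ˡ; ++⁻ʳ; concat⁺; replicate⁺; applyUpTo⁺₂)
open import Data.List.Relation.Unary.Any using (here; there; index)
open import Data.List.Relation.Unary.Any.Properties using (lookup-index)
open import Data.List.Membership.Propositional using (_∈_)
open import Data.List.Membership.Propositional.Properties
  using (∈-map⁺; ∈-++⁺ˡ; ∈-++⁺ʳ; ∈-allFin; ∈-cartesianProduct⁺)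
open import Data.Vec using (Vec; tabulate) renaming ([] to []ᵛ; _∷_ to _∷ᵛ_; lookup to lookupᵛ)
open import Data.Vec.Properties using (lookup∘tabulate)
open import Data.Bool using (Bool; true; false; T)
open import Data.Maybe using (Maybe; just; nothing)
open import Data.Maybe.Properties using (just-injective)
open import Data.Product using (_,_; proj₁; proj₂; ∃₂; map₂)
open import Data.Empty using (⊥-elim)
open import Function.Bundles using (Equivalence)
open import Relation.Nullary using (Dec; yes; no)
open import Relation.Nullary.Decidable using (isYes; toWitness; fromWitness)
open import Relation.Binary.PropositionalEquality hiding ([_])

private variable
  A : Set
  n : ℕ

_!_ : List A → ℕ → Maybe A
[] ! t = nothing
(x ∷ xs) ! zero = just x
(x ∷ xs) ! suc t = xs ! t

!-++ˡ : (xs ys : List A) {t : ℕ} → t < length xs → (xs ++ ys) ! t ≡ xs ! t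
!-++ˡ (x ∷ xs) ys {zero} _ = refl
!-++ˡ (x ∷ xs) ys {suc t} (s≤s p) = !-++ˡ xs ys p

at : (xs : List A) (t : ℕ) → t < length xs → A
at (x ∷ xs) zero _ = x
at (x ∷ xs) (suc t) (s≤s p) = at xs t p

!-at : (xs : List A) (t : ℕ) (p : t < length xs) → xs ! t ≡ just (at xs t p)
!-at (x ∷ xs) zero _ = refl
!-at (x ∷ xs) (suc t) (s≤s p) = !-at xs t p

All-at : {P : A → Set} (xs : List A) {t : ℕ} {p : t < length xs} → All P xs → P (at xs t p)
All-at (_ ∷ _) {zero} (px ∷ _) = px
All-at (_ ∷ xs) {suc t} {s≤s p} (_ ∷ pxs) = All-at xs pxs

∷-view : (xs : List A) → 0 < length xs → Σ A λ x → Σ (List A) λ ys → xs ≡ x ∷ ys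
∷-view (x ∷ ys) _ = x , ys , refl

pigeonhole-∈ : (E : List A) (f : Fin (suc (length E)) → A) → (∀ i → f i ∈ E) →
               ∃₂ λ i j → i <ᶠ j × f i ≡ f j
pigeonhole-∈ E f f∈E with pigeonhole ≤-refl (λ i → index (f∈E i))
... | i , j , i<j , same = i , j , i<j ,
      trans (lookup-index (f∈E i)) (trans (cong (lookup E) same) (sym (lookup-index (f∈E j))))

allBoolVecs : (m : ℕ) → List (Vec Bool m)
allBoolVecs zero = []ᵛ ∷ []
allBoolVecs (suc m) = map (true ∷ᵛ_) (allBoolVecs m) ++ map (false ∷ᵛ_) (allBoolVecs m)

∈-allBoolVecs : ∀ {m} (v : Vec Bool m) → v ∈ allBoolVecs m
∈-allBoolVecs []ᵛ = here refl
∈-allBoolVecs (true ∷ᵛ v) = ∈-++⁺ˡ (∈-map⁺ (true ∷ᵛ_) (∈-allBoolVecs v))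
∈-allBoolVecs {suc m} (false ∷ᵛ v) =
  ∈-++⁺ʳ (map (true ∷ᵛ_) (allBoolVecs m)) (∈-map⁺ (false ∷ᵛ_) (∈-allBoolVecs v))

isYes-transfer : {P R : Set} (p? : Dec P) (r? : Dec R) → isYes p? ≡ isYes r? → P → R
isYes-transfer p? r? same p = toWitness {a? = r?} (subst T same (fromWitness {a? = p?} p))

applyUpTo-+ : (f : ℕ → A) (i p : ℕ) →
              applyUpTo f (i + p) ≡ applyUpTo f i ++ applyUpTo (λ x → f (i + x)) p
applyUpTo-+ f zero p = refl
applyUpTo-+ f (suc i) p = cong (f 0 ∷_) (applyUpTo-+ (λ x → f (suc x)) i p)

sum-map-∈ : (f : A → ℕ) {x : A} {xs : List A} → x ∈ xs → f x ≤ sum (map f xs)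
sum-map-∈ f (here refl) = m≤m+n _ _
sum-map-∈ f {xs = y ∷ _} (there p) = ≤-trans (sum-map-∈ f p) (m≤n+m _ (f y))

-- Prefixes of infinite words

_≼_ : List (Fin n) → Word n → Set
U ≼ w = pref w (length U) ≡ U

tail : Word n → Word n
tail w i = w (suc i)

length-pref : (v : Word n) (m : ℕ) → length (pref v m) ≡ m
length-pref v zero = refl
length-pref v (suc m) = cong suc (length-pref (tail v) m)

pref-cong : (v v' : Word n) (m : ℕ) → (∀ t → t < m → v t ≡ v' t) → pref v m ≡ pref v' m
pref-cong v v' zero _ = refl
pref-cong v v' (suc m) eq = cong₂ _∷_ (eq 0 (s≤s z≤n)) (pref-cong _ _ m (λ t p → eq (suc t) (s≤s p)))

pref-snoc : (v : Word n) (m : ℕ) → pref v (suc m) ≡ pref v m ++ [ v m ]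
pref-snoc v zero = refl
pref-snoc v (suc m) = cong (v 0 ∷_) (pref-snoc (tail v) m)

All-pref : {P : Fin n → Set} (v : Word n) → (∀ t → P (v t)) → ∀ m → All P (pref v m)
All-pref v Pv zero = []
All-pref v Pv (suc m) = Pv 0 ∷ All-pref (tail v) (λ t → Pv (suc t)) m

!⇒≼ : (w : Word n) (U : List (Fin n)) → (∀ t → t < length U → U ! t ≡ just (w t)) → U ≼ w
!⇒≼ w [] _ = refl
!⇒≼ w (x ∷ U) eq =
  cong₂ _∷_ (sym (just-injective (eq 0 (s≤s z≤n)))) (!⇒≼ (tail w) U (λ t p → eq (suc t) (s≤s p)))

≼-agree : (w w' : Word n) (U : List (Fin n)) → U ≼ w → U ≼ w' → ∀ {t} → t < length U → w t ≡ w' t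
≼-agree w w' (x ∷ U) U≼w U≼w' {zero} _ = trans (∷-injectiveˡ U≼w) (sym (∷-injectiveˡ U≼w'))
≼-agree w w' (x ∷ U) U≼w U≼w' {suc t} (s≤s p) =
  ≼-agree (tail w) (tail w') U (∷-injectiveʳ U≼w) (∷-injectiveʳ U≼w') p

≼-++⁻ˡ : (w : Word n) (U V : List (Fin n)) → (U ++ V) ≼ w → U ≼ w
≼-++⁻ˡ w [] V _ = refl
≼-++⁻ˡ w (x ∷ U) V eq = cong₂ _∷_ (∷-injectiveˡ eq) (≼-++⁻ˡ (tail w) U V (∷-injectiveʳ eq))

≼-cong : (w w' : Word n) (U : List (Fin n)) → U ≼ w → (∀ t → t < length U → w t ≡ w' t) → U ≼ w'
≼-cong w w' U U≼w w≗w' = trans (pref-cong w' w (length U) (λ t p → sym (w≗w' t p))) U≼w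

≼-split : (w : Word n) (U : List (Fin n)) (m : ℕ) → U ≼ w → m ≤ length U →
          Σ (List (Fin n)) λ R → U ≡ pref w m ++ R
≼-split w U zero _ _ = U , refl
≼-split w (x ∷ U) (suc m) eq (s≤s p) with ≼-split (tail w) U m (∷-injectiveʳ eq) p
... | R , U≡ = R , cong₂ _∷_ (sym (∷-injectiveˡ eq)) U≡

-- Morphisms and images of infinite words

infixr 9 _⊙_
_⊙_ : Morphism n → Morphism n → Morphism n
(f ⊙ g) a = concatMap f (g a)

concatMap-⊙ : (f g : Morphism n) (u : List (Fin n)) →
              concatMap (f ⊙ g) u ≡ concatMap f (concatMap g u)
concatMap-⊙ f g [] = refl
concatMap-⊙ f g (a ∷ u) =
  trans (cong (concatMap f (g a) ++_) (concatMap-⊙ f g u)) (sym (concatMap-++ f (g a) (concatMap g u)))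

All-concatMap⁺ : {P Q : Fin n → Set} (f : Morphism n) → (∀ d → P d → All Q (f d)) →
                 ∀ u → All P u → All Q (concatMap f u)
All-concatMap⁺ f PQ [] [] = []
All-concatMap⁺ f PQ (d ∷ u) (pd ∷ pu) = ++⁺ (PQ d pd) (All-concatMap⁺ f PQ u pu)

All-concatMap⁻ : {Q : Fin n → Set} (f : Morphism n) →
                 ∀ u → All Q (concatMap f u) → All (λ d → All Q (f d)) u
All-concatMap⁻ f [] _ = []
All-concatMap⁻ f (d ∷ u) q = ++⁻ˡ (f d) q ∷ All-concatMap⁻ f u (++⁻ʳ (f d) q)

length-concatMap-≥ : (f : Morphism n) → NonErasing f → ∀ u → length u ≤ length (concatMap f u)
length-concatMap-≥ f ne [] = z≤n
length-concatMap-≥ f ne (a ∷ u) =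
  subst (suc (length u) ≤_) (sym (length-++ (f a))) (+-mono-≤ (ne a) (length-concatMap-≥ f ne u))

length-concatMap-≤ : (f : Morphism n) (B : ℕ) → (∀ a → length (f a) ≤ B) →
                     ∀ u → length (concatMap f u) ≤ length u * B
length-concatMap-≤ f B fB [] = z≤n
length-concatMap-≤ f B fB (a ∷ u) =
  subst (_≤ B + length u * B) (sym (length-++ (f a))) (+-mono-≤ (fB a) (length-concatMap-≤ f B fB u))

NonErasing-⊙ : (f g : Morphism n) → NonErasing f → NonErasing g → NonErasing (f ⊙ g)
NonErasing-⊙ f g nf ng a = ≤-trans (ng a) (length-concatMap-≥ f nf (g a))

IsImage-cong : (f : Morphism n) {v v' w w' : Word n} → v ≗ v' → w ≗ w' →
               IsImage f v w → IsImage f v' w'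
IsImage-cong f {v} {v'} {w} {w'} v≗v' w≗w' f[v]=w m =
  trans (pref-cong w' w _ (λ t _ → sym (w≗w' t)))
    (trans (cong (λ u → pref w (length (concatMap f u))) (sym pv≡pv'))
      (trans (f[v]=w m) (cong (concatMap f) pv≡pv')))
  where pv≡pv' = pref-cong v v' m (λ t _ → v≗v' t)

IsImage-congᵐ : {f g : Morphism n} {v w : Word n} → f ≗ g → IsImage f v w → IsImage g v w
IsImage-congᵐ {w = w} f≗g f[v]=w m = subst (_≼ w) (concatMap-cong f≗g (pref _ m)) (f[v]=w m)

IsImage-id : (v : Word n) → IsImage [_] v v
IsImage-id v m =
  trans (cong (λ u → pref v (length u)) (concatMap-pure (pref v m)))
    (trans (cong (pref v) (length-pref v m)) (sym (concatMap-pure (pref v m))))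

IsImage-⊙ : (f g : Morphism n) {v u w : Word n} → IsImage g v u → IsImage f u w → IsImage (f ⊙ g) v w
IsImage-⊙ f g {v} {w = w} g[v]=u f[u]=w m =
  subst (_≼ w) (sym (trans (concatMap-⊙ f g (pref v m)) (cong (concatMap f) (sym (g[v]=u m)))))
    (f[u]=w (length (concatMap g (pref v m))))

IsImage-head : (f : Morphism n) {v w : Word n} → IsImage f v w → ∀ {x t} → f (v 0) ≡ x ∷ t → w 0 ≡ x
IsImage-head f {w = w} f[v]=w f[v₀]≡ = ∷-injectiveˡ (subst (λ u → (u ++ []) ≼ w) f[v₀]≡ (f[v]=w 1))

IsImage-unique : (f : Morphism n) → NonErasing f → {v w w' : Word n} →
                 IsImage f v w → IsImage f v w' → ∀ t → w t ≡ w' t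
IsImage-unique f ne {v} {w} {w'} f[v]=w f[v]=w' t =
  ≼-agree w w' _ (f[v]=w (suc t)) (f[v]=w' (suc t))
    (≤-trans (≤-reflexive (sym (length-pref v (suc t))))
             (length-concatMap-≥ f ne (pref v (suc t))))

module Limit (P : ℕ → List (Fin n)) (P-grows : ∀ t → Σ (List (Fin n)) λ R → P (suc t) ≡ P t ++ R)
             (P-long : ∀ t → t < length (P t)) where

  limit : Word n
  limit i = at (P i) i (P-long i)

  private
    P-extends : ∀ t d → Σ (List (Fin n)) λ R → P (d + t) ≡ P t ++ R
    P-extends t zero = [] , sym (++-identityʳ (P t))
    P-extends t (suc d) with P-extends t d | P-grows (d + t)
    ... | R , e | R' , e' = R ++ R' , trans e' (trans (cong (_++ R') e) (++-assoc (P t) R R'))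

    P-coherent : ∀ s t → s < length (P t) → P t ! s ≡ P s ! s
    P-coherent s t s<∣Pt∣ with P-extends t s | P-extends s t
    ... | R , e | R' , e' = begin
      P t ! s           ≡⟨ !-++ˡ (P t) R s<∣Pt∣ ⟨
      (P t ++ R) ! s    ≡⟨ cong (_! s) e ⟨
      P (s + t) ! s     ≡⟨ cong (λ k → P k ! s) (+-comm s t) ⟩
      P (t + s) ! s     ≡⟨ cong (_! s) e' ⟩
      (P s ++ R') ! s   ≡⟨ !-++ˡ (P s) R' (P-long s) ⟩
      P s ! s           ∎
      where open ≡-Reasoning

  P≼limit : ∀ t → P t ≼ limit
  P≼limit t = !⇒≼ limit (P t) λ s p → trans (P-coherent s t p) (!-at (P s) s (P-long s))

module Image (f : Morphism n) (ne : NonErasing f) (v : Word n) where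
  private
    P : ℕ → List (Fin n)
    P t = concatMap f (pref v (suc t))

    P-grows : ∀ t → Σ (List (Fin n)) λ R → P (suc t) ≡ P t ++ R
    P-grows t = f (v (suc t)) ++ [] ,
      trans (cong (concatMap f) (pref-snoc v (suc t))) (concatMap-++ f (pref v (suc t)) _)

    P-long : ∀ t → t < length (P t)
    P-long t = ≤-trans (≤-reflexive (sym (length-pref v (suc t)))) (length-concatMap-≥ f ne (pref v (suc t)))

    open Limit P P-grows P-long

  image : Word n
  image = limit

  IsImage-image : IsImage f v image
  IsImage-image zero = refl
  IsImage-image (suc m) = P≼limit m

-- Compositions and powers of morphisms

compose : List (Morphism n) → Morphism n
compose [] = [_]
compose (m ∷ ms) = m ⊙ compose ms

compose-++ : (ms ms' : List (Morphism n)) (a : Fin n) →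
             compose (ms ++ ms') a ≡ (compose ms ⊙ compose ms') a
compose-++ [] ms' a = sym (concatMap-pure (compose ms' a))
compose-++ (m ∷ ms) ms' a =
  trans (cong (concatMap m) (compose-++ ms ms' a)) (sym (concatMap-⊙ m (compose ms) (compose ms' a)))

NonErasing-compose : (ms : List (Morphism n)) → All NonErasing ms → NonErasing (compose ms)
NonErasing-compose [] [] a = s≤s z≤n
NonErasing-compose (m ∷ ms) (ne ∷ nes) = NonErasing-⊙ m (compose ms) ne (NonErasing-compose ms nes)

power : Morphism n → ℕ → Morphism n
power τ zero = [_]
power τ (suc q) = τ ⊙ power τ q

power-+ : (τ : Morphism n) (p q : ℕ) (a : Fin n) → power τ (p + q) a ≡ (power τ p ⊙ power τ q) a
power-+ τ zero q a = sym (concatMap-pure (power τ q a))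
power-+ τ (suc p) q a =
  trans (cong (concatMap τ) (power-+ τ p q a)) (sym (concatMap-⊙ τ (power τ p) (power τ q a)))

compose-replicate : (ms : List (Morphism n)) (q : ℕ) (a : Fin n) →
                    compose (concat (replicate q ms)) a ≡ power (compose ms) q a
compose-replicate ms zero a = refl
compose-replicate ms (suc q) a =
  trans (compose-++ ms _ a) (cong (concatMap (compose ms)) (compose-replicate ms q a))

NonErasing-power : (τ : Morphism n) → NonErasing τ → ∀ q → NonErasing (power τ q)
NonErasing-power τ ne zero a = s≤s z≤n
NonErasing-power τ ne (suc q) = NonErasing-⊙ τ (power τ q) ne (NonErasing-power τ ne q)

power-fixes : (τ : Morphism n) (c : Fin n) → τ c ≡ [ c ] → ∀ q → power τ q c ≡ [ c ]
power-fixes τ c τc≡c zero = refl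
power-fixes τ c τc≡c (suc q) rewrite power-fixes τ c τc≡c q | τc≡c = refl

Closed : Morphism n → (Fin n → Set) → Set
Closed τ Q = ∀ d → Q d → All Q (τ d)

Closed-power : (τ : Morphism n) (Q : Fin n → Set) → Closed τ Q → ∀ q → Closed (power τ q) Q
Closed-power τ Q τQ zero d qd = qd ∷ []
Closed-power τ Q τQ (suc q) d qd = All-concatMap⁺ τ τQ (power τ q d) (Closed-power τ Q τQ q d qd)

-- Fixed points

_◂_ : Fin n → Word n → Word n
(c ◂ z) zero = c
(c ◂ z) (suc i) = z i

◂-fixed : (ρ : Morphism n) (c : Fin n) (z : Word n) → ρ c ≡ [ c ] →
          IsImage ρ z z → IsImage ρ (c ◂ z) (c ◂ z)
◂-fixed ρ c z ρc≡c fixed zero = refl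
◂-fixed ρ c z ρc≡c fixed (suc m) rewrite ρc≡c = cong (c ∷_) (fixed m)

constant-fixed : (ρ : Morphism n) (c : Fin n) → ρ c ≡ [ c ] → IsImage ρ (λ _ → c) (λ _ → c)
constant-fixed ρ c ρc≡c m =
  subst (_≼ (λ _ → c)) (sym (image≡ m)) (cong (pref (λ _ → c)) (length-pref _ m))
  where
  image≡ : ∀ m → concatMap ρ (pref (λ _ → c) m) ≡ pref (λ _ → c) m
  image≡ zero = refl
  image≡ (suc m) rewrite ρc≡c = cong (c ∷_) (image≡ m)

module FixedPoint (ρ : Morphism n) (ne : NonErasing ρ) (a : Fin n) (s : List (Fin n))
                  (ρa : ρ a ≡ a ∷ s) (s-nonempty : 0 < length s) where
  private
    Tail : ℕ → List (Fin n)
    Tail zero = []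
    Tail (suc t) = s ++ concatMap ρ (Tail t)

    P : ℕ → List (Fin n)
    P t = a ∷ Tail t

    Tail-grows : ∀ t → Σ (List (Fin n)) λ R → Tail (suc t) ≡ Tail t ++ R
    Tail-grows zero = s , ++-identityʳ s
    Tail-grows (suc t) with Tail-grows t
    ... | R , e = concatMap ρ R ,
      trans (cong (λ u → s ++ concatMap ρ u) e)
        (trans (cong (s ++_) (concatMap-++ ρ (Tail t) R)) (sym (++-assoc s _ _)))

    Tail-long : ∀ t → t ≤ length (Tail t)
    Tail-long zero = z≤n
    Tail-long (suc t) = subst (suc t ≤_) (sym (length-++ s))
      (+-mono-≤ s-nonempty (≤-trans (Tail-long t) (length-concatMap-≥ ρ ne (Tail t))))

    ρ[P]≡P : ∀ t → concatMap ρ (P t) ≡ P (suc t)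
    ρ[P]≡P t = cong (_++ concatMap ρ (Tail t)) ρa

    open Limit P (λ t → map₂ (cong (a ∷_)) (Tail-grows t)) (λ t → s≤s (Tail-long t))

  fixedPoint : Word n
  fixedPoint = limit

  fixedPoint-fixed : IsImage ρ fixedPoint fixedPoint
  fixedPoint-fixed m with ≼-split limit (P m) m (P≼limit m) (<⇒≤ (s≤s (Tail-long m)))
  ... | R , Pm≡ = ≼-++⁻ˡ limit (concatMap ρ (pref limit m)) (concatMap ρ R)
    (subst (_≼ limit)
      (trans (sym (ρ[P]≡P m)) (trans (cong (concatMap ρ) Pm≡) (concatMap-++ ρ (pref limit m) R)))
      (P≼limit (suc m)))

  fixedPoint-tail : (Q : Fin n → Set) → Closed ρ Q → All Q s → ∀ m → Q (fixedPoint (suc m))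
  fixedPoint-tail Q ρQ Qs m = All-at (Tail (suc m)) (All-Tail (suc m))
    where
    All-Tail : ∀ t → All Q (Tail t)
    All-Tail zero = []
    All-Tail (suc t) = ++⁺ Qs (All-concatMap⁺ ρ ρQ (Tail t) (All-Tail t))

headOr : Fin n → List (Fin n) → Fin n
headOr e [] = e
headOr e (x ∷ _) = x

headOr-concatMap : (f : Morphism n) → NonErasing f →
                   ∀ e x u → headOr e (concatMap f (x ∷ u)) ≡ headOr e (f x)
headOr-concatMap f ne e x u with f x | ne x
... | _ ∷ _ | _ = refl

prolongable⇒fixedWord : (ρ : Morphism n) → NonErasing ρ → (Q : Fin n → Set) → Closed ρ Q →
                      ∀ x s → ρ x ≡ x ∷ s → Q x →
                      Σ (Word n) λ z → (∀ m → Q (z m)) × IsImage ρ z z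
prolongable⇒fixedWord ρ ne Q ρQ x [] ρx Qx = (λ _ → x) , (λ _ → Qx) , constant-fixed ρ x ρx
prolongable⇒fixedWord ρ ne Q ρQ x s@(_ ∷ _) ρx Qx = fixedPoint , Q-fixedPoint , fixedPoint-fixed
  where
  open FixedPoint ρ ne x s ρx (s≤s z≤n)
  Q-fixedPoint : ∀ m → Q (fixedPoint m)
  Q-fixedPoint zero = Qx
  Q-fixedPoint (suc m) = fixedPoint-tail Q ρQ (++⁻ʳ [ x ] (subst (All Q) ρx (ρQ x Qx))) m

-- The first letters of τⁱ(e) repeat, so some letter x returns as the first letter of τᵖ(x), p ≥ 1.
powerFixedWord : (τ : Morphism n) → NonErasing τ → (Q : Fin n → Set) → Closed τ Q → ∀ e → Q e →
                 Σ ℕ λ q → Σ (Word n) λ z → (∀ m → Q (z m)) × IsImage (power τ (suc q)) z z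
powerFixedWord {n} τ ne Q τQ e Qe
  with i , j , i<j , same-head ← pigeonhole ≤-refl (λ (i : Fin (suc n)) → headOr e (power τ (toℕ i) e))
  with o , i+o≡j ← m≤n⇒∃[o]m+o≡n i<j
  with x , X , τⁱe≡ ← ∷-view (power τ (toℕ i) e) (NonErasing-power τ ne (toℕ i) e)
  with x' , s , ρx≡ ← ∷-view (power τ (suc o) x) (NonErasing-power τ ne (suc o) x)
  = o , prolongable⇒fixedWord ρ (NonErasing-power τ ne (suc o)) Q (Closed-power τ Q τQ (suc o))
          x s (trans ρx≡ (cong (_∷ s) (sym x≡x'))) Qx
  where
  ρ = power τ (suc o)

  Qx : Q x
  Qx with Closed-power τ Q τQ (toℕ i) e Qe
  ... | Qτⁱe rewrite τⁱe≡ with Qτⁱe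
  ... | Qx ∷ _ = Qx

  x≡x' : x ≡ x'
  x≡x' = begin
    x                                         ≡⟨ cong (headOr e) τⁱe≡ ⟨
    headOr e (power τ (toℕ i) e)              ≡⟨ same-head ⟩
    headOr e (power τ (toℕ j) e)              ≡⟨ cong (λ k → headOr e (power τ k e)) j≡ ⟩
    headOr e (power τ (suc o + toℕ i) e)      ≡⟨ cong (headOr e) (power-+ τ (suc o) (toℕ i) e) ⟩
    headOr e (concatMap ρ (power τ (toℕ i) e)) ≡⟨ cong (λ u → headOr e (concatMap ρ u)) τⁱe≡ ⟩
    headOr e (concatMap ρ (x ∷ X))            ≡⟨ headOr-concatMap ρ (NonErasing-power τ ne (suc o)) e x X ⟩
    headOr e (ρ x)                            ≡⟨ cong (headOr e) ρx≡ ⟩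
    x'                                        ∎
    where
    open ≡-Reasoning
    j≡ : toℕ j ≡ suc o + toℕ i
    j≡ = trans (sym i+o≡j) (cong suc (+-comm (toℕ i) o))

fixedWordStartingWith : (τ : Morphism n) → NonErasing τ → (Q : Fin n → Set) → Closed τ Q →
                 ∀ c t → τ c ≡ c ∷ t → All Q t → ∀ e → Q e →
                 Σ ℕ λ q → Σ (Word n) λ y →
                   y 0 ≡ c × (∀ m → Q (y (suc m))) × IsImage (power τ (suc q)) y y
fixedWordStartingWith τ ne Q τQ c t@(_ ∷ _) τc Qt e Qe =
  0 , fixedPoint , refl , fixedPoint-tail Q τQ Qt ,
  IsImage-congᵐ (λ a → sym (++-identityʳ (τ a))) fixedPoint-fixed
  where open FixedPoint τ ne c t τc (s≤s z≤n)
fixedWordStartingWith τ ne Q τQ c [] τc _ e Qe with powerFixedWord τ ne Q τQ e Qe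
... | q , z , Qz , fixed = q , c ◂ z , refl , Qz , ◂-fixed _ c z (power-fixes τ c τc (suc q)) fixed

-- Membership in Stab

PreimageIn : List (Morphism n) → (Word n → Set) → Word n → Set
PreimageIn {n} S Pr w = Σ (Morphism n) λ σ → σ ∈ S × Σ (Word n) λ v → Pr v × IsImage σ v w

NonErasing-compose-∈ : {S : List (Morphism n)} → All NonErasing S →
                       (ms : List (Morphism n)) → All (_∈ S) ms → NonErasing (compose ms)
NonErasing-compose-∈ neS ms ms∈S = NonErasing-compose ms (mapᴬ (lookupᴬ neS) ms∈S)

Stab-coinduction : (S : List (Morphism n)) (Pr : Word n → Set) → (∀ w → Pr w → PreimageIn S Pr w) →
                   ∀ w → Pr w → Stab S w
Stab-coinduction {n} S Pr step w Prw =
  (λ k → proj₁ (step′ k)) , (λ k → proj₁ (level k)) , (λ k → proj₁ (proj₂ (step′ k))) ,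
  (λ _ → refl) ,
  (λ k → proj₂ (proj₂ (proj₂ (proj₂ (step′ k)))))
  where
  level : ℕ → Σ (Word n) Pr
  step′ : ∀ k → PreimageIn S Pr (proj₁ (level k))
  level zero = w , Prw
  level (suc k) = proj₁ (proj₂ (proj₂ (step′ k))) , proj₁ (proj₂ (proj₂ (proj₂ (step′ k))))
  step′ k = step (proj₁ (level k)) (proj₂ (level k))

Stab-fixedPointImage : (S : List (Morphism n)) → All NonErasing S →
  (m₀ : Morphism n) (ms₀ : List (Morphism n)) → All (_∈ S) (m₀ ∷ ms₀) →
  (y : Word n) → IsImage (compose (m₀ ∷ ms₀)) y y →
  (ms : List (Morphism n)) → All (_∈ S) ms → ∀ w → IsImage (compose ms) y w → Stab S w
Stab-fixedPointImage {n} S neS m₀ ms₀ m₀ms₀∈S y fixed ms ms∈S w y↦w =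
  Stab-coinduction S ImageOfY step w (ms , ms∈S , y↦w)
  where
  ImageOfY : Word n → Set
  ImageOfY w = Σ (List (Morphism n)) λ ms → All (_∈ S) ms × IsImage (compose ms) y w

  peel : ∀ w m ms → All (_∈ S) (m ∷ ms) → IsImage (compose (m ∷ ms)) y w → PreimageIn S ImageOfY w
  peel w m ms (m∈S ∷ ms∈S) y↦w = m , m∈S , v , (ms , ms∈S , IsImage-image) , v↦w
    where
    neᵐ = lookupᴬ neS m∈S
    neᶜ = NonErasing-compose-∈ neS ms ms∈S
    open Image (compose ms) neᶜ y using (image; IsImage-image)
    v = image
    open Image m neᵐ v using () renaming (image to mv; IsImage-image to v↦mv)
    v↦w : IsImage m v w
    v↦w = IsImage-cong m (λ _ → refl)
            (IsImage-unique (m ⊙ compose ms) (NonErasing-⊙ m (compose ms) neᵐ neᶜ)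
              (IsImage-⊙ m (compose ms) IsImage-image v↦mv) y↦w)
            v↦mv

  step : ∀ w → ImageOfY w → PreimageIn S ImageOfY w
  step w (m ∷ ms , ms∈S , y↦w) = peel w m ms ms∈S y↦w
  step w ([] , [] , y↦w) =
    peel w m₀ ms₀ m₀ms₀∈S
      (IsImage-cong _ (λ _ → refl) (IsImage-unique [_] (λ _ → s≤s z≤n) (IsImage-id y) y↦w) fixed)

-- The words ιo^ω and (ιoᵏ)^ω

module TwoLetters (o ι : Fin n) (o≢ι : o ≢ ι) where

  ιoω : Word n
  ιoω zero = ι
  ιoω (suc _) = o

  ιoω-not-Episturmian : ¬ Episturmian ιoω
  ιoω-not-Episturmian (reversal-closed , _) with reversal-closed (ι ∷ o ∷ []) (0 , refl)
  ... | i , oι-at-i = o≢ι (trans (cong ιoω (+-comm 1 i)) (∷-injectiveˡ (∷-injectiveʳ oι-at-i)))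

  o*≼ιoω : (U : List (Fin n)) → All (_≡ o) U → (ι ∷ U) ≼ ιoω
  o*≼ιoω U os = cong (ι ∷_) (o*≼oω U os)
    where
    o*≼oω : (U : List (Fin n)) → All (_≡ o) U → U ≼ (λ _ → o)
    o*≼oω [] [] = refl
    o*≼oω (_ ∷ U) (refl ∷ os) = cong (o ∷_) (o*≼oω U os)

  ≼ιoω⇒o* : (x : Fin n) (U : List (Fin n)) → (x ∷ U) ≼ ιoω → x ≡ ι × All (_≡ o) U
  ≼ιoω⇒o* x U xU≼ = sym (∷-injectiveˡ xU≼) , subst (All (_≡ o)) (∷-injectiveʳ xU≼) (os (length U))
    where
    os : ∀ m → All (_≡ o) (pref (λ _ → o) m)
    os zero = []
    os (suc m) = refl ∷ os m

  ιoᵏω : ℕ → Word n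
  ιoᵏω k x with suc k ∣? x
  ... | yes _ = ι
  ... | no _ = o

  ιoᵏω-∣ : ∀ k {x} → suc k ∣ x → ιoᵏω k x ≡ ι
  ιoᵏω-∣ k {x} k+1∣x with suc k ∣? x
  ... | yes _ = refl
  ... | no k+1∤x = ⊥-elim (k+1∤x k+1∣x)

  ιoᵏω-∤ : ∀ k {x} → ¬ suc k ∣ x → ιoᵏω k x ≡ o
  ιoᵏω-∤ k {x} k+1∤x with suc k ∣? x
  ... | yes k+1∣x = ⊥-elim (k+1∤x k+1∣x)
  ... | no _ = refl

  ιoᵏω-ι⇒∣ : ∀ k {x} → ιoᵏω k x ≡ ι → suc k ∣ x
  ιoᵏω-ι⇒∣ k {x} eq with suc k ∣? x
  ... | yes k+1∣x = k+1∣x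
  ... | no _ = ⊥-elim (o≢ι eq)

  ιoᵏω-cong : ∀ k {a b} → (suc k ∣ a → suc k ∣ b) → (suc k ∣ b → suc k ∣ a) →
              ιoᵏω k a ≡ ιoᵏω k b
  ιoᵏω-cong k {a} {b} a⇒b b⇒a with suc k ∣? a | suc k ∣? b
  ... | yes _ | yes _ = refl
  ... | no _ | no _ = refl
  ... | yes ∣a | no ∤b = ⊥-elim (∤b (a⇒b ∣a))
  ... | no ∤a | yes ∣b = ⊥-elim (∤a (b⇒a ∣b))

  ιoᵏω-reflect : ∀ k {a b} → suc k ∣ a + b → ιoᵏω k a ≡ ιoᵏω k b
  ιoᵏω-reflect k {a} {b} ∣a+b =
    ιoᵏω-cong k (∣m+n∣m⇒∣n ∣a+b) (∣m+n∣m⇒∣n (subst (suc k ∣_) (+-comm a b) ∣a+b))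

  ιoᵏω-translate : ∀ k {a b} s → suc k ∣ a + s → suc k ∣ b + s → ιoᵏω k a ≡ ιoᵏω k b
  ιoᵏω-translate k {a} {b} s ∣a+s ∣b+s = ιoᵏω-cong k (shift-∣ ∣a+s ∣b+s) (shift-∣ ∣b+s ∣a+s)
    where
    shift-∣ : ∀ {a b} → suc k ∣ a + s → suc k ∣ b + s → suc k ∣ a → suc k ∣ b
    shift-∣ {a} {b} ∣a+s ∣b+s ∣a =
      ∣m+n∣m⇒∣n (subst (suc k ∣_) (+-comm b s) ∣b+s) (∣m+n∣m⇒∣n ∣a+s ∣a)

  ιoᵏω-agrees : ∀ k t → t < suc k → ιoᵏω k t ≡ ιoω t
  ιoᵏω-agrees k zero _ = ιoᵏω-∣ k (divides 0 refl)
  ιoᵏω-agrees k (suc t) (s≤s t<k) = ιoᵏω-∤ k λ k+1∣t+1 → <⇒≱ (s≤s t<k) (∣⇒≤ k+1∣t+1)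

  reverse-pref : (v : Word n) (m : ℕ) → reverse (pref v m) ≡ pref (λ t → v (m ∸ suc t)) m
  reverse-pref v zero = refl
  reverse-pref v (suc m) = trans (cong reverse (pref-snoc v m))
    (trans (reverse-++ (pref v m) [ v m ]) (cong (v m ∷_) (reverse-pref v m)))

  -- A factor at i of length m + 1 is mirrored by the factor at k (i + m): positions add up to (k + 1) (i + m).
  ιoᵏω-reversal-closed : ∀ k u → Factor u (ιoᵏω k) → Factor (reverse u) (ιoᵏω k)
  ιoᵏω-reversal-closed k [] _ = 0 , refl
  ιoᵏω-reversal-closed k u@(_ ∷ u') (i , u-at-i) =
    j , trans (cong (pref (shift w j)) (length-reverse u))
          (sym (trans (cong reverse (sym u-at-i))
                 (trans (reverse-pref (shift w i) (suc m))
                        (pref-cong _ (shift w j) (suc m) mirror))))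
    where
    w = ιoᵏω k
    m = length u'
    j = k * (i + m)
    mirror : ∀ t → t < suc m → w (i + (m ∸ t)) ≡ w (j + t)
    mirror t (s≤s t≤m) =
      ιoᵏω-reflect k (subst (suc k ∣_) (sym positions-sum) (divides (i + m) (*-comm (suc k) (i + m))))
      where
      positions-sum : i + (m ∸ t) + (j + t) ≡ suc k * (i + m)
      positions-sum = trans (rearrange i (m ∸ t) t j) (cong (λ x → i + x + j) (m∸n+n≡m t≤m))
        where
        rearrange : ∀ a b c d → a + b + (d + c) ≡ a + (b + c) + d
        rearrange = solve-∀

  ιoᵏω-leftSpecial : ∀ k u → LeftSpecial u (ιoᵏω k) → u ≡ pref (λ _ → o) (length u)
  ιoᵏω-leftSpecial k u (x , y , x≢y , (p , xu-at-p) , (p' , yu-at-p')) =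
    trans (sym (∷-injectiveʳ xu-at-p))
      (pref-cong _ _ (length u) λ t t<∣u∣ → ιoᵏω-∤ k (no-ι t t<∣u∣))
    where
    w = ιoᵏω k
    no-ι : ∀ t → t < length u → ¬ suc k ∣ p + suc t
    no-ι t t<∣u∣ k+1∣ = x≢y (begin
      x          ≡⟨ ∷-injectiveˡ xu-at-p ⟨
      w (p + 0)  ≡⟨ ιoᵏω-translate k (suc t) (aligned p k+1∣) (aligned p' k+1∣') ⟩
      w (p' + 0) ≡⟨ ∷-injectiveˡ yu-at-p' ⟩
      y          ∎)
      where
      open ≡-Reasoning
      k+1∣' : suc k ∣ p' + suc t
      k+1∣' = ιoᵏω-ι⇒∣ k
        (trans (sym (≼-agree _ _ u (∷-injectiveʳ xu-at-p) (∷-injectiveʳ yu-at-p') t<∣u∣))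
               (ιoᵏω-∣ k k+1∣))
      aligned : ∀ q → suc k ∣ q + suc t → suc k ∣ q + 0 + suc t
      aligned q = subst (λ z → suc k ∣ z + suc t) (sym (+-identityʳ q))

  ιoᵏω-Episturmian : ∀ k → Episturmian (ιoᵏω k)
  ιoᵏω-Episturmian k = ιoᵏω-reversal-closed k , λ u v u-special v-special ∣u∣≡∣v∣ →
    trans (ιoᵏω-leftSpecial k u u-special)
      (trans (cong (pref (λ _ → o)) ∣u∣≡∣v∣) (sym (ιoᵏω-leftSpecial k v v-special)))

IsDerivation : (ℕ → Morphism n) → (ℕ → Word n) → Set
IsDerivation σs ws = ∀ l → IsImage (σs l) (ws (suc l)) (ws l)

IsImage-applyUpTo : (σs : ℕ → Morphism n) (ws : ℕ → Word n) → IsDerivation σs ws →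
                    ∀ l → IsImage (compose (applyUpTo σs l)) (ws l) (ws 0)
IsImage-applyUpTo σs ws ws-images zero = IsImage-id (ws 0)
IsImage-applyUpTo σs ws ws-images (suc l) =
  IsImage-⊙ (σs 0) _
    (IsImage-applyUpTo (λ x → σs (suc x)) (λ x → ws (suc x)) (λ x → ws-images (suc x)) l)
    (ws-images 0)

IsImage-segment : (σs : ℕ → Morphism n) (ws : ℕ → Word n) → IsDerivation σs ws →
                  ∀ i l → IsImage (compose (applyUpTo (λ x → σs (i + x)) l)) (ws (i + l)) (ws i)
IsImage-segment σs ws ws-images i l =
  IsImage-cong _ (λ _ → refl) (λ t → cong (λ z → ws z t) (+-identityʳ i))
    (IsImage-applyUpTo (λ x → σs (i + x)) (λ x → ws (i + x))
      (λ x → IsImage-cong (σs (i + x)) (λ t → cong (λ z → ws z t) (sym (+-suc i x))) (λ _ → refl)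
                          (ws-images (i + x)))
      l)

module Desubstitution (S : List (Morphism n)) (neS : All NonErasing S) (o ι : Fin n) (o≢ι : o ≢ ι) where
  open TwoLetters o ι o≢ι

  L : ℕ
  L = suc (sum (map (λ σ → sum (map (λ a → length (σ a)) (allFin n))) S))

  length-≤L : ∀ {σ} → σ ∈ S → ∀ a → length (σ a) ≤ L
  length-≤L {σ} σ∈S a =
    ≤-trans (sum-map-∈ (λ a → length (σ a)) (∈-allFin a))
      (≤-trans (sum-map-∈ (λ σ → sum (map (λ a → length (σ a)) (allFin n))) σ∈S) (n≤1+n _))

  length-compose-≤ : ∀ ms → All (_∈ S) ms → ∀ a → length (compose ms a) ≤ L ^ length ms
  length-compose-≤ [] [] a = ≤-refl
  length-compose-≤ (m ∷ ms) (m∈S ∷ ms∈S) a =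
    ≤-trans (length-concatMap-≤ m L (length-≤L m∈S) (compose ms a))
      (subst (_≤ L ^ suc (length ms)) (*-comm L _) (*-monoʳ-≤ L (length-compose-≤ ms ms∈S a)))

  States : List (Fin n × Vec Bool n)
  States = cartesianProduct (allFin n) (allBoolVecs n)

  K : ℕ
  K = length States

  -- With this k, up to level K of a derivation the images of the first two letters fit in the prefix ιoᵏ.
  k : ℕ
  k = 2 * L ^ K

  module _ (σs : ℕ → Morphism n) (ws : ℕ → Word n) (σs∈S : ∀ l → σs l ∈ S)
           (ws₀≗ : ∀ i → ws 0 i ≡ ιoᵏω k i) (ws-images : IsDerivation σs ws) where

    C : ℕ → Morphism n
    C l = compose (applyUpTo σs l)

    C-∈S : ∀ l → All (_∈ S) (applyUpTo σs l)
    C-∈S l = applyUpTo⁺₂ σs l σs∈S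

    C[ws]≡ιoᵏω : ∀ l → IsImage (C l) (ws l) (ιoᵏω k)
    C[ws]≡ιoᵏω l = IsImage-cong (C l) (λ _ → refl) ws₀≗ (IsImage-applyUpTo σs ws ws-images l)

    length-C-≤ : ∀ l → l ≤ K → ∀ a → length (C l a) ≤ L ^ K
    length-C-≤ l l≤K a =
      ≤-trans (subst (λ e → length (C l a) ≤ L ^ e) (length-applyUpTo σs l)
                     (length-compose-≤ _ (C-∈S l) a))
        (^-monoʳ-≤ L l≤K)

    first-blocks≼ιoω : ∀ l → l ≤ K → (C l (ws l 0) ++ (C l (ws l 1) ++ [])) ≼ ιoω
    first-blocks≼ιoω l l≤K = ≼-cong (ιoᵏω k) ιoω _ (C[ws]≡ιoᵏω l 2) λ t t<∣blocks∣ →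
      ιoᵏω-agrees k t (≤-trans t<∣blocks∣
        (≤-trans (length-concatMap-≤ (C l) (L ^ K) (length-C-≤ l l≤K) (pref (ws l) 2)) (n≤1+n k)))

    record FirstBlocks (l : ℕ) : Set where
      field
        rest : List (Fin n)
        first≡ : C l (ws l 0) ≡ ι ∷ rest
        rest-o : All (_≡ o) rest
        second-o : All (_≡ o) (C l (ws l 1))

    first-blocks : ∀ l → l ≤ K → FirstBlocks l
    first-blocks l l≤K
      with x , X , C[ws₀]≡ ← ∷-view (C l (ws l 0)) (NonErasing-compose-∈ neS _ (C-∈S l) (ws l 0))
      with x≡ι , os ← ≼ιoω⇒o* x (X ++ (C l (ws l 1) ++ []))
                        (subst (λ u → (u ++ (C l (ws l 1) ++ [])) ≼ ιoω) C[ws₀]≡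
                               (first-blocks≼ιoω l l≤K))
      = record { rest = X ; first≡ = trans C[ws₀]≡ (cong (_∷ X) x≡ι) ; rest-o = ++⁻ˡ X os
               ; second-o = ++⁻ˡ (C l (ws l 1)) (++⁻ʳ X os) }

    OBlock : ℕ → Fin n → Set
    OBlock l d = All (_≡ o) (C l d)

    o-block? : ℕ → Fin n → Bool
    o-block? l d = isYes (all? (_≟ᶠ o) (C l d))

    state : ℕ → Fin n × Vec Bool n
    state l = ws l 0 , tabulate (o-block? l)

    module RepeatedState (i p : ℕ) (j≤K : i + suc p ≤ K) (same-state : state i ≡ state (i + suc p)) where
      j = i + suc p
      c = ws i 0
      segment = applyUpTo (λ x → σs (i + x)) (suc p)
      τ = compose segment

      module Bᵢ = FirstBlocks (first-blocks i (≤-trans (m≤m+n i (suc p)) j≤K))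
      module Bⱼ = FirstBlocks (first-blocks j j≤K)

      segment-∈S : All (_∈ S) segment
      segment-∈S = applyUpTo⁺₂ _ (suc p) (λ x → σs∈S (i + x))

      ne-τ : NonErasing τ
      ne-τ = NonErasing-compose-∈ neS segment segment-∈S

      C-split : ∀ d → C j d ≡ concatMap (C i) (τ d)
      C-split d = trans (cong (λ ms → compose ms d) (applyUpTo-+ σs i (suc p)))
                        (compose-++ (applyUpTo σs i) segment d)

      same-o-blocks : ∀ d → o-block? i d ≡ o-block? j d
      same-o-blocks d = trans (sym (lookup∘tabulate (o-block? i) d))
        (trans (cong (λ s → lookupᵛ (proj₂ s) d) same-state) (lookup∘tabulate (o-block? j) d))

      OBlockᵢ⇒OBlockⱼ : ∀ d → OBlock i d → OBlock j d
      OBlockᵢ⇒OBlockⱼ d =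
        isYes-transfer (all? (_≟ᶠ o) (C i d)) (all? (_≟ᶠ o) (C j d)) (same-o-blocks d)

      OBlockⱼ⇒OBlockᵢ : ∀ d → OBlock j d → OBlock i d
      OBlockⱼ⇒OBlockᵢ d =
        isYes-transfer (all? (_≟ᶠ o) (C j d)) (all? (_≟ᶠ o) (C i d)) (sym (same-o-blocks d))

      τ-closed : Closed τ (OBlock i)
      τ-closed d od = All-concatMap⁻ (C i) (τ d) (subst (All (_≡ o)) (C-split d) (OBlockᵢ⇒OBlockⱼ d od))

      wsⱼ₀≡c : ws j 0 ≡ c
      wsⱼ₀≡c = cong proj₁ (sym same-state)

      τc≡c∷ : Σ (List (Fin n)) λ t → τ c ≡ c ∷ t
      τc≡c∷ with x , t , τc≡ ← ∷-view (τ c) (ne-τ c) =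
        t , trans τc≡ (cong (_∷ t) (sym (IsImage-head τ (IsImage-segment σs ws ws-images i (suc p))
                                                          (trans (cong τ wsⱼ₀≡c) τc≡))))

      t = proj₁ τc≡c∷

      t-blocks : All (OBlock i) t
      t-blocks = All-concatMap⁻ (C i) t (++⁻ʳ Bᵢ.rest (subst (All (_≡ o)) restⱼ≡ Bⱼ.rest-o))
        where
        open ≡-Reasoning
        restⱼ≡ : Bⱼ.rest ≡ Bᵢ.rest ++ concatMap (C i) t
        restⱼ≡ = ∷-injectiveʳ (begin
          ι ∷ Bⱼ.rest                      ≡⟨ Bⱼ.first≡ ⟨
          C j (ws j 0)                     ≡⟨ cong (C j) wsⱼ₀≡c ⟩
          C j c                            ≡⟨ C-split c ⟩
          concatMap (C i) (τ c)            ≡⟨ cong (concatMap (C i)) (proj₂ τc≡c∷) ⟩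
          C i c ++ concatMap (C i) t       ≡⟨ cong (_++ concatMap (C i) t) Bᵢ.first≡ ⟩
          ι ∷ Bᵢ.rest ++ concatMap (C i) t ∎)

      C[c·OBlocks]≡ιoω : (y : Word n) → y 0 ≡ c → (∀ m → OBlock i (y (suc m))) →
                         IsImage (C i) y ιoω
      C[c·OBlocks]≡ιoω y y₀≡c y-tail zero = refl
      C[c·OBlocks]≡ιoω y y₀≡c y-tail (suc m) =
        subst (λ u → (u ++ W) ≼ ιoω) (sym (trans (cong (C i) y₀≡c) Bᵢ.first≡))
          (o*≼ιoω (Bᵢ.rest ++ W)
            (++⁺ Bᵢ.rest-o (All-concatMap⁺ (C i) (λ _ od → od) _ (All-pref (tail y) y-tail m))))
        where W = concatMap (C i) (pref (tail y) m)

      Stab-ιoω : Stab S ιoω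
      Stab-ιoω
        with q , y , y₀≡c , y-tail , y-fixed
               ← fixedWordStartingWith τ ne-τ (OBlock i) τ-closed c t (proj₂ τc≡c∷) t-blocks
                   (ws j 1) (OBlockⱼ⇒OBlockᵢ (ws j 1) Bⱼ.second-o)
        -- The morphism list σs (i + 0) ∷ … below is concat (replicate (suc q) segment).
        = Stab-fixedPointImage S neS (σs (i + 0))
            (applyUpTo (λ x → σs (i + suc x)) p ++ concat (replicate q segment))
            (concat⁺ (replicate⁺ (suc q) segment-∈S)) y
            (IsImage-congᵐ (λ a → sym (compose-replicate segment (suc q) a)) y-fixed)
            (applyUpTo σs i) (C-∈S i) ιoω (C[c·OBlocks]≡ιoω y y₀≡c y-tail)

    Stab-ιoω : Stab S ιoω
    Stab-ιoω
      with i , j , i<j , same ← pigeonhole-∈ States (λ l → state (toℕ l))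
                                  (λ l → ∈-cartesianProduct⁺ (∈-allFin _) (∈-allBoolVecs _))
      with p , i+1+p≡j ← m≤n⇒∃[o]m+o≡n i<j
      = RepeatedState.Stab-ιoω (toℕ i) p j≤K (trans same (cong state (sym j≡)))
      where
      j≡ : toℕ i + suc p ≡ toℕ j
      j≡ = trans (+-suc (toℕ i) p) i+1+p≡j
      j≤K : toℕ i + suc p ≤ K
      j≤K = subst (_≤ K) (sym j≡) (≤-pred (toℕ<n j))

  Stab-ιoᵏω⇒Stab-ιoω : Stab S (ιoᵏω k) → Stab S ιoω
  Stab-ιoᵏω⇒Stab-ιoω (σs , ws , σs∈S , ws₀≗ , ws-images) = Stab-ιoω σs ws σs∈S ws₀≗ ws-images

proposition6p9 : (n : ℕ) → 2 ≤ n →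
    ¬ (Σ (List (Morphism n)) λ S →
         All NonErasing S × (∀ (w : Word n) → Episturmian w ⇔ Stab S w))
proposition6p9 (suc (suc n)) (s≤s (s≤s z≤n)) (S , neS , episturmian⇔Stab) =
  ιoω-not-Episturmian (from (episturmian⇔Stab ιoω)
    (Stab-ιoᵏω⇒Stab-ιoω (to (episturmian⇔Stab (ιoᵏω k)) (ιoᵏω-Episturmian k))))
  where
  open TwoLetters {suc (suc n)} 0F 1F (λ ())
  open Desubstitution S neS 0F 1F (λ ())
  open Equivalence
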